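{- Let $G=(V,E^+,E^-)$ be a signed graph whose flow clutter $\mathcal F$ is weakly MNI, and let $x$ be a fractional vertex of $\mathsf P_{A(\mathcal F)}$. Then $0<x_e<1$ for all $e\in E^+$ and $x_e<1$ for all $e\in E^-$.
   Context: A signed graph $G=(V,E^+,E^-)$ is a (multi)graph with edge set $E=E^+\cup E^-$ partitioned into positive and negative edges. A circuit is a cycle without repeated vertices (as an edge set); a flow is a circuit with exactly one negative edge. The flow clutter $\mathcal F$ is the family of edge sets of flows of $G$, ground set $E$, and $\mathsf P_{A(\mathcal F)}=\{x\in\mathbb R^E: x\ge 0,\ \sum_{e\in C}x_e\ge1\ \forall C\in\mathcal F\}$. A vertex is fractional if it has a non-integer coordinate. A clutter is ideal if its covering polyhedron (defined analogously) is integral. Contraction $\mathcal C/e$: minimal sets among $\{C\setminus\{e\}\}$; deletion $\mathcal C\setminus e=\{C: e\notin C\}$. A strong minor of $\mathcal F$ is a minor obtained by contracting positive edges and deleting arbitrary edges without creating singleton members (equivalently the flow clutter of a signed graph obtained from $G$ by contracting positive edges and deleting arbitrary edges without creating self-loops). $\mathcal F$ is weakly MNI if it is not ideal but every proper strong minor is ideal.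
   Formalization: Points of $\mathsf P_{A(\mathcal F)}$ and of the polyhedra of its strong minors have rational rather than real coordinates, so the vertex x and the idealness conditions in weakly MNI are taken over ℚ. -}

module Defs where

open import Data.Nat using (ℕ; suc; NonZero)
open import Data.Nat.DivMod using (_%_; m%n<n)
open import Data.Fin using (Fin; toℕ; fromℕ<; _≟_)
open import Data.Bool using (Bool; true; false; if_then_else_; _∧_; _∨_; not)
open import Data.Integer using (ℤ)
open import Data.Rational using (ℚ; 0ℚ; 1ℚ; _+_; _*_; _-_; _≤_; _<_; _/_)
open import Data.Product using (Σ; ∃; _×_; _,_)
open import Data.Sum using (_⊎_)
open import Relation.Binary.PropositionalEquality using (_≡_)
open import Relation.Nullary using (¬_)
open import Relation.Nullary.Decidable using (⌊_⌋)

-- Signed (multi)graphs: n vertices, m edges (Fin m), each edge has two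
-- (possibly equal) ends; neg e ≡ true means e ∈ E⁻, false means e ∈ E⁺.

record SignedGraph (n m : ℕ) : Set where
  field
    ends : Fin m → Fin n × Fin n
    neg  : Fin m → Bool
open SignedGraph public

Joins : ∀ {n m} → SignedGraph n m → Fin m → Fin n → Fin n → Set
Joins G f a b = (ends G f ≡ (a , b)) ⊎ (ends G f ≡ (b , a))

next : ∀ {k} → Fin (suc k) → Fin (suc k)
next {k} i = fromℕ< (m%n<n (suc (toℕ i)) (suc k))

-- A circuit: a closed walk v₀ e₀ v₁ e₁ … v_k e_k v₀ (length k+1 ≥ 1)
-- with no repeated vertices and no repeated edges.
record Circuit {n m} (G : SignedGraph n m) : Set where
  field
    len  : ℕ
    vtx  : Fin (suc len) → Fin n
    edg  : Fin (suc len) → Fin m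
    vtx-inj : ∀ i j → vtx i ≡ vtx j → i ≡ j
    edg-inj : ∀ i j → edg i ≡ edg j → i ≡ j
    joins   : ∀ i → Joins G (edg i) (vtx i) (vtx (next i))
open Circuit public

IsFlow : ∀ {n m} {G : SignedGraph n m} → Circuit G → Set
IsFlow {G = G} c =
  ∃ λ i → (neg G (edg c i) ≡ true) × (∀ j → neg G (edg c j) ≡ true → j ≡ i)

Subset : ℕ → Set
Subset m = Fin m → Bool

_∈_ : ∀ {m} → Fin m → Subset m → Set
e ∈ S = S e ≡ true

_⊆_ : ∀ {m} → Subset m → Subset m → Set
S ⊆ T = ∀ e → e ∈ S → e ∈ T

singleton : ∀ {m} → Fin m → Subset m
singleton e f = ⌊ f ≟ e ⌋

Family : ℕ → Set₁
Family m = Subset m → Set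

EdgeSetOf : ∀ {n m} {G : SignedGraph n m} → Circuit G → Subset m → Set
EdgeSetOf c S = ∀ e → (e ∈ S → ∃ λ i → edg c i ≡ e) × (∃ (λ i → edg c i ≡ e) → e ∈ S)

FlowClutter : ∀ {n m} → SignedGraph n m → Family m
FlowClutter G S = Σ (Circuit G) λ c → IsFlow c × EdgeSetOf c S

sumFin : ∀ m → (Fin m → ℚ) → ℚ
sumFin ℕ.zero    f = 0ℚ
sumFin (suc m) f = f Fin.zero + sumFin m (λ i → f (Fin.suc i))

sumOver : ∀ {m} → Subset m → (Fin m → ℚ) → ℚ
sumOver {m} S x = sumFin m (λ e → if S e then x e else 0ℚ)

-- Covering polyhedron of a clutter `fam` on ground set `ground` ⊆ Fin m.
-- Points are x : Fin m → ℚ whose coordinates outside the ground set are 0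
-- (an affine copy of the polyhedron in ℚ^ground).
InP : ∀ {m} → Subset m → Family m → (Fin m → ℚ) → Set
InP ground fam x =
  (∀ e → ground e ≡ false → x e ≡ 0ℚ) ×
  (∀ e → 0ℚ ≤ x e) ×
  (∀ S → fam S → 1ℚ ≤ sumOver S x)

IsVertex : ∀ {m} → Subset m → Family m → (Fin m → ℚ) → Set
IsVertex ground fam x =
  InP ground fam x ×
  ¬ (∃ λ (y : Fin _ → ℚ) → ∃ λ (z : Fin _ → ℚ) → ∃ λ (λ' : ℚ) →
       InP ground fam y × InP ground fam z ×
       (0ℚ < λ') × (λ' < 1ℚ) ×
       ¬ (∀ e → y e ≡ z e) ×
       (∀ e → x e ≡ λ' * y e + (1ℚ - λ') * z e))

IsInteger : ℚ → Set
IsInteger q = ∃ λ (k : ℤ) → q ≡ k / 1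

Fractional : ∀ {m} → (Fin m → ℚ) → Set
Fractional x = ∃ λ e → ¬ IsInteger (x e)

Ideal : ∀ {m} → Subset m → Family m → Set
Ideal ground fam = ∀ x → IsVertex ground fam x → ∀ e → IsInteger (x e)

full : ∀ {m} → Subset m
full _ = true

-- Minors: delete I, contract J (I, J disjoint).
-- 𝓒 \ I / J = minimal sets of { C ∖ J : C ∈ 𝓒, C ∩ I = ∅ }, ground E ∖ (I ∪ J).

MinorPre : ∀ {m} → Family m → Subset m → Subset m → Family m
MinorPre fam I J S =
  ∃ λ C → fam C × (∀ e → e ∈ C → I e ≡ false) × (∀ e → S e ≡ (C e ∧ not (J e)))

Minor : ∀ {m} → Family m → Subset m → Subset m → Family m
Minor fam I J S =
  MinorPre fam I J S × (∀ T → MinorPre fam I J T → T ⊆ S → S ⊆ T)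

minorGround : ∀ {m} → Subset m → Subset m → Subset m
minorGround I J e = not (I e ∨ J e)

ProperStrongMinor : ∀ {n m} → SignedGraph n m → Subset m → Subset m → Set
ProperStrongMinor G I J =
  (∀ e → e ∈ I → J e ≡ false) ×
  (∀ e → e ∈ J → neg G e ≡ false) ×
  (∃ λ e → (e ∈ I) ⊎ (e ∈ J)) ×
  (∀ e → Minor (FlowClutter G) I J (singleton e) → FlowClutter G (singleton e))

WeaklyMNI : ∀ {n m} → SignedGraph n m → Set
WeaklyMNI G =
  ¬ Ideal full (FlowClutter G) ×
  (∀ I J → ProperStrongMinor G I J →
     Ideal (minorGround I J) (Minor (FlowClutter G) I J))

{-# OPTIONS --safe #-}
-- Every coordinate of a vertex x is at most 1: if x_f > 1, then x is the midpoint of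
-- x[f ≔ 1] and x[f ≔ 2x_f − 1]. If x_f = 1, then x[f ≔ 0] is a vertex of the deletion of f
-- (points of that polyhedron lift back to P(𝓕) by restoring the value x_f ≥ 1 at f); the
-- deletion is ideal, so x is integral off f, and also at f, contradicting fractionality.
-- If x_e = 0 for a positive edge e, then x lies in the polyhedron of the contraction of e,
-- which is contained in P(𝓕), so x is a vertex there; the contraction is a proper strong
-- minor because a flow C with C ∖ e = {f} would give 1 ≤ x(C) = x_f. Its idealness again
-- makes x integral.
module Submission where

open import Defs
open import Data.Nat using (ℕ)
open import Data.Fin using (Fin)
open import Data.Bool using (true; false)
open import Data.Rational using (ℚ; 0ℚ; 1ℚ; _<_)
open import Data.Product using (_×_)
open import Relation.Binary.PropositionalEquality using (_≡_)

open import Data.Bool using (if_then_else_; _∧_; _∨_; not)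
open import Data.Bool.Properties using (∧-identityʳ; ∧-conicalˡ) renaming (_≟_ to _≟ᵇ_)
open import Data.Fin using (zero; suc; _≟_)
import Data.Fin.Properties as Fin
import Data.Fin.Subset as VecSubset
import Data.Fin.Subset.Induction as VecSubset using (⊂-wellFounded)
import Data.Integer as ℤ
open import Data.Product using (∃; _,_; proj₁; proj₂)
open import Data.Rational using (_+_; _*_; _-_; -_; _≤_; ½)
open import Data.Rational.Properties
  using ( ≤-refl; ≤-reflexive; ≤-trans; ≤-antisym; <⇒≤; <⇒≢; ≰⇒>; ≮⇒≥; _≤?_; _<?_; <-irrefl; <-≤-trans
        ; +-mono-≤; +-mono-<; +-monoˡ-<; +-identityˡ; +-identityʳ)
open import Data.Rational.Solver using (module +-*-Solver)
open import Data.Sum using (_⊎_; inj₁; inj₂)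
open import Data.Vec using (tabulate)
open import Data.Vec.Functional using (updateAt)
open import Data.Vec.Functional.Properties using (updateAt-updates; updateAt-minimal)
open import Data.Vec.Properties using (lookup∘tabulate; []=⇒lookup; lookup⇒[]=)
open import Function using (_∘_; const; case_of_)
open import Induction.WellFounded using (WellFounded; Acc; acc; module Subrelation)
open import Relation.Binary.PropositionalEquality
  using (refl; sym; trans; cong; cong₂; subst; _≢_; module ≡-Reasoning)
import Relation.Binary.Construct.On as On
open import Relation.Nullary using (¬_; Dec; yes; no; contradiction; _→-dec_)
open import Relation.Nullary.Decidable using (from-yes)

private
  variable
    n m : ℕ

0≤1 : 0ℚ ≤ 1ℚ
0≤1 = from-yes (0ℚ ≤? 1ℚ)

0<½ : 0ℚ < ½
0<½ = from-yes (0ℚ <? ½)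

½<1 : ½ < 1ℚ
½<1 = from-yes (½ <? 1ℚ)

combination-self : ∀ l a → a ≡ l * a + (1ℚ - l) * a
combination-self = solve 2 (λ l a → a := l :* a :+ (con 1ℚ :- l) :* a) refl
  where open +-*-Solver

midpoint-reflection : ∀ a → a ≡ ½ * 1ℚ + (1ℚ - ½) * (a + a - 1ℚ)
midpoint-reflection = solve 1 (λ a → a := con ½ :* con 1ℚ :+ (con 1ℚ :- con ½) :* (a :+ a :- con 1ℚ)) refl
  where open +-*-Solver

sumFin-cong : ∀ m {f g : Fin m → ℚ} → (∀ i → f i ≡ g i) → sumFin m f ≡ sumFin m g
sumFin-cong ℕ.zero    f≗g = refl
sumFin-cong (ℕ.suc m) f≗g = cong₂ _+_ (f≗g zero) (sumFin-cong m (f≗g ∘ suc))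

sumFin-mono : ∀ m {f g : Fin m → ℚ} → (∀ i → f i ≤ g i) → sumFin m f ≤ sumFin m g
sumFin-mono ℕ.zero    f≤g = ≤-refl
sumFin-mono (ℕ.suc m) f≤g = +-mono-≤ (f≤g zero) (sumFin-mono m (f≤g ∘ suc))

sumFin-const-0 : ∀ m → sumFin m (const 0ℚ) ≡ 0ℚ
sumFin-const-0 ℕ.zero    = refl
sumFin-const-0 (ℕ.suc m) = trans (+-identityˡ _) (sumFin-const-0 m)

sumFin-nonneg : ∀ m {f : Fin m → ℚ} → (∀ i → 0ℚ ≤ f i) → 0ℚ ≤ sumFin m f
sumFin-nonneg m {f} f≥0 = subst (_≤ sumFin m f) (sumFin-const-0 m) (sumFin-mono m f≥0)

term≤sumFin : ∀ m {f : Fin m → ℚ} → (∀ i → 0ℚ ≤ f i) → ∀ i → f i ≤ sumFin m f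
term≤sumFin (ℕ.suc m) {f} f≥0 zero =
  subst (_≤ sumFin (ℕ.suc m) f) (+-identityʳ (f zero))
    (+-mono-≤ (≤-refl {f zero}) (sumFin-nonneg m (f≥0 ∘ suc)))
term≤sumFin (ℕ.suc m) {f} f≥0 (suc i) =
  subst (_≤ sumFin (ℕ.suc m) f) (+-identityˡ (f (suc i)))
    (+-mono-≤ (f≥0 zero) (term≤sumFin m (f≥0 ∘ suc) i))

sumFin-single : ∀ m {f : Fin m → ℚ} i → (∀ j → j ≢ i → f j ≡ 0ℚ) → sumFin m f ≡ f i
sumFin-single (ℕ.suc m) {f} zero f≡0 = begin
  f zero + sumFin m (f ∘ suc) ≡⟨ cong (f zero +_) (sumFin-cong m (λ j → f≡0 (suc j) λ ())) ⟩
  f zero + sumFin m (const 0ℚ) ≡⟨ cong (f zero +_) (sumFin-const-0 m) ⟩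
  f zero + 0ℚ                  ≡⟨ +-identityʳ (f zero) ⟩
  f zero                       ∎
  where open ≡-Reasoning
sumFin-single (ℕ.suc m) {f} (suc i) f≡0 = begin
  f zero + sumFin m (f ∘ suc) ≡⟨ cong (_+ sumFin m (f ∘ suc)) (f≡0 zero λ ()) ⟩
  0ℚ + sumFin m (f ∘ suc)     ≡⟨ +-identityˡ _ ⟩
  sumFin m (f ∘ suc)          ≡⟨ sumFin-single m i (λ j j≢i → f≡0 (suc j) (j≢i ∘ Fin.suc-injective)) ⟩
  f (suc i)                   ∎
  where open ≡-Reasoning

∅ : Subset m
∅ _ = false

_∖_ : Subset m → Subset m → Subset m
(S ∖ J) e = S e ∧ not (J e)

∈-singleton : (e : Fin m) → e ∈ singleton e
∈-singleton e with e ≟ e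
... | yes _   = refl
... | no e≢e = contradiction refl e≢e

∉-singleton : {e f : Fin m} → f ≢ e → singleton e f ≡ false
∉-singleton {e = e} {f} f≢e with f ≟ e
... | yes f≡e = contradiction f≡e f≢e
... | no _    = refl

∈-singleton⇒≡ : {e f : Fin m} → f ∈ singleton e → f ≡ e
∈-singleton⇒≡ {e = e} {f} f∈ with f ≟ e
... | yes f≡e = f≡e
∈-singleton⇒≡ () | no _

vanishes-on-singleton : {x : Fin m → ℚ} {e : Fin m} → x e ≡ 0ℚ → ∀ f → f ∈ singleton e → x f ≡ 0ℚ
vanishes-on-singleton {x = x} xe≡0 f f∈e = trans (cong x (∈-singleton⇒≡ f∈e)) xe≡0

∉⇒avoids-singleton : {S : Subset m} {f : Fin m} → ¬ f ∈ S → ∀ e → e ∈ S → singleton f e ≡ false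
∉⇒avoids-singleton f∉S e e∈S = ∉-singleton λ { refl → f∉S e∈S }

avoids-singleton⇒≢ : {S : Subset m} {f : Fin m} → (∀ e → e ∈ S → singleton f e ≡ false) →
  ∀ e → e ∈ S → e ≢ f
avoids-singleton⇒≢ avoids e e∈S refl = contradiction (trans (sym (avoids e e∈S)) (∈-singleton e)) λ ()

∖-⊆ : (S J : Subset m) → (S ∖ J) ⊆ S
∖-⊆ S J e = ∧-conicalˡ (S e) (not (J e))

sumOver-cong : {S T : Subset m} {y z : Fin m → ℚ} →
  (∀ e → S e ≡ T e) → (∀ e → e ∈ S → y e ≡ z e) → sumOver S y ≡ sumOver T z
sumOver-cong {m} {S} {T} {y} {z} S≗T y≗z = sumFin-cong m term
  where
  term : ∀ e → (if S e then y e else 0ℚ) ≡ (if T e then z e else 0ℚ)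
  term e with S e | T e | S≗T e | y≗z e
  ... | true  | .true  | refl | y≡z = y≡z refl
  ... | false | .false | refl | _   = refl

sumOver-mono : {S T : Subset m} {y : Fin m → ℚ} → (∀ e → 0ℚ ≤ y e) →
  T ⊆ S → sumOver T y ≤ sumOver S y
sumOver-mono {m} {S} {T} {y} y≥0 T⊆S = sumFin-mono m term
  where
  term : ∀ e → (if T e then y e else 0ℚ) ≤ (if S e then y e else 0ℚ)
  term e with T e | S e | T⊆S e
  ... | true  | true  | _ = ≤-refl
  ... | true  | false | h = contradiction (h refl) λ ()
  ... | false | true  | _ = y≥0 e
  ... | false | false | _ = ≤-refl

∈⇒≤sumOver : {S : Subset m} {y : Fin m → ℚ} → (∀ e → 0ℚ ≤ y e) →
  ∀ {e} → e ∈ S → y e ≤ sumOver S y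
∈⇒≤sumOver {m} {S} {y} y≥0 {e} e∈S =
  subst (λ b → (if b then y e else 0ℚ) ≤ sumOver S y) e∈S (term≤sumFin m term≥0 e)
  where
  term≥0 : ∀ e → 0ℚ ≤ (if S e then y e else 0ℚ)
  term≥0 e with S e
  ... | true  = y≥0 e
  ... | false = ≤-refl

sumOver-singleton : (e : Fin m) (y : Fin m → ℚ) → sumOver (singleton e) y ≡ y e
sumOver-singleton {m} e y =
  trans (sumFin-single m e vanish) (cong (λ b → if b then y e else 0ℚ) (∈-singleton e))
  where
  vanish : ∀ f → f ≢ e → (if singleton e f then y f else 0ℚ) ≡ 0ℚ
  vanish f f≢e rewrite ∉-singleton f≢e = refl

sumOver-∖ : {S J : Subset m} {y : Fin m → ℚ} → (∀ e → e ∈ J → y e ≡ 0ℚ) →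
  sumOver (S ∖ J) y ≡ sumOver S y
sumOver-∖ {m} {S} {J} {y} y≡0 = sumFin-cong m term
  where
  term : ∀ e → (if S e ∧ not (J e) then y e else 0ℚ) ≡ (if S e then y e else 0ℚ)
  term e with S e | J e | y≡0 e
  ... | true  | true  | h = sym (h refl)
  ... | true  | false | _ = refl
  ... | false | _     | _ = refl

_⊆?_ : (S T : Subset m) → Dec (S ⊆ T)
S ⊆? T = Fin.all? λ e → (S e ≟ᵇ true) →-dec (T e ≟ᵇ true)

_⊂_ : Subset m → Subset m → Set
T ⊂ S = T ⊆ S × ∃ λ e → e ∈ S × ¬ e ∈ T

⊈⇒∃∉ : {S T : Subset m} → ¬ S ⊆ T → ∃ λ e → e ∈ S × ¬ e ∈ T
⊈⇒∃∉ {m} {S} {T} S⊈T with Fin.¬∀⟶∃¬ m _ (λ e → (S e ≟ᵇ true) →-dec (T e ≟ᵇ true)) S⊈T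
... | e , ¬[e∈S→e∈T] with S e ≟ᵇ true
...   | yes e∈S = e , e∈S , ¬[e∈S→e∈T] ∘ const
...   | no e∉S = contradiction (λ e∈S → contradiction e∈S e∉S) ¬[e∈S→e∈T]

∈⇒∈-tabulate : {S : Subset m} {e : Fin m} → e ∈ S → e VecSubset.∈ tabulate S
∈⇒∈-tabulate {S = S} {e} e∈S = lookup⇒[]= e (tabulate S) (trans (lookup∘tabulate S e) e∈S)

∈-tabulate⇒∈ : {S : Subset m} {e : Fin m} → e VecSubset.∈ tabulate S → e ∈ S
∈-tabulate⇒∈ {S = S} {e} e∈S = trans (sym (lookup∘tabulate S e)) ([]=⇒lookup e∈S)

⊂⇒tabulate-⊂ : {S T : Subset m} → T ⊂ S → tabulate T VecSubset.⊂ tabulate S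
⊂⇒tabulate-⊂ (T⊆S , e , e∈S , e∉T) =
  (λ e∈T → ∈⇒∈-tabulate (T⊆S _ (∈-tabulate⇒∈ e∈T))) ,
  e , ∈⇒∈-tabulate e∈S , e∉T ∘ ∈-tabulate⇒∈

⊂-wellFounded : WellFounded (_⊂_ {m})
⊂-wellFounded = Subrelation.wellFounded ⊂⇒tabulate-⊂ (On.wellFounded tabulate VecSubset.⊂-wellFounded)

-- Membership in P need not be decidable, so the induction decides the covering inequality instead.
covers-minimal⇒covers : (P : Family m) {y : Fin m → ℚ} → (∀ e → 0ℚ ≤ y e) →
  (∀ S → P S → (∀ T → P T → T ⊆ S → S ⊆ T) → 1ℚ ≤ sumOver S y) →
  ∀ S → P S → 1ℚ ≤ sumOver S y
covers-minimal⇒covers P {y} y≥0 covers-minimal S = go S (⊂-wellFounded S)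
  where
  go : ∀ S → Acc _⊂_ S → P S → 1ℚ ≤ sumOver S y
  go S (acc smaller) PS with 1ℚ ≤? sumOver S y
  ... | yes 1≤yS = 1≤yS
  ... | no 1≰yS = contradiction (covers-minimal S PS minimal) 1≰yS
    where
    minimal : ∀ T → P T → T ⊆ S → S ⊆ T
    minimal T PT T⊆S with S ⊆? T
    ... | yes S⊆T = S⊆T
    ... | no S⊈T = contradiction
      (≤-trans (go T (smaller (T⊆S , ⊈⇒∃∉ S⊈T)) PT) (sumOver-mono y≥0 T⊆S)) 1≰yS

covers-MinorPre : {F : Family m} {ground I J : Subset m} {w : Fin m → ℚ} →
  InP ground (Minor F I J) w → ∀ S → MinorPre F I J S → 1ℚ ≤ sumOver S w
covers-MinorPre {F = F} {I = I} {J} (_ , w≥0 , covers) =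
  covers-minimal⇒covers (MinorPre F I J) w≥0 λ S pre minimal → covers S (pre , minimal)

∉minorGround : {I J : Subset m} {e : Fin m} → minorGround I J e ≡ false → e ∈ I ⊎ e ∈ J
∉minorGround {I = I} {J} {e} outside with I e | J e
... | true  | _    = inj₁ refl
... | false | true = inj₂ refl

∈⇒∉minorGround : {I J : Subset m} {e : Fin m} → e ∈ I → minorGround I J e ≡ false
∈⇒∉minorGround {J = J} {e} e∈I = cong (λ b → not (b ∨ J e)) e∈I

updateAt-const-preserves : {A : Set} (P : A → Set) {y : Fin m → A} (f : Fin m) {a : A} →
  P a → (∀ e → P (y e)) → ∀ e → P (updateAt y f (const a) e)
updateAt-const-preserves P {y} f Pa Py e with e ≟ f
... | yes refl = subst P (sym (updateAt-updates e y)) Pa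
... | no e≢f   = subst P (sym (updateAt-minimal e f y e≢f)) (Py e)

updateAt-combination : {x y z : Fin m → ℚ} {l a b : ℚ} (f : Fin m) →
  (∀ e → e ≢ f → x e ≡ l * y e + (1ℚ - l) * z e) → x f ≡ l * a + (1ℚ - l) * b →
  ∀ e → x e ≡ l * updateAt y f (const a) e + (1ℚ - l) * updateAt z f (const b) e
updateAt-combination {y = y} {z} {l} f off at e with e ≟ f
... | yes refl = trans at (cong₂ (λ u v → l * u + (1ℚ - l) * v)
                                 (sym (updateAt-updates e y)) (sym (updateAt-updates e z)))
... | no e≢f   = trans (off e e≢f) (cong₂ (λ u v → l * u + (1ℚ - l) * v)
                                 (sym (updateAt-minimal e f y e≢f)) (sym (updateAt-minimal e f z e≢f)))

InP-updateAt : {F : Family m} {y : Fin m → ℚ} (f : Fin m) {a : ℚ} → 1ℚ ≤ a → (∀ e → 0ℚ ≤ y e) →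
  (∀ S → F S → ¬ f ∈ S → 1ℚ ≤ sumOver S y) → InP full F (updateAt y f (const a))
InP-updateAt {F = F} {y} f {a} 1≤a y≥0 covers-avoiding = (λ _ ()) , y′≥0 , covers
  where
  y′ = updateAt y f (const a)
  y′≥0 : ∀ e → 0ℚ ≤ y′ e
  y′≥0 = updateAt-const-preserves (0ℚ ≤_) f (≤-trans 0≤1 1≤a) y≥0
  covers : ∀ S → F S → 1ℚ ≤ sumOver S y′
  covers S FS with S f ≟ᵇ true
  ... | yes f∈S =
    ≤-trans 1≤a (subst (_≤ sumOver S y′) (updateAt-updates f y) (∈⇒≤sumOver y′≥0 f∈S))
  ... | no f∉S = ≤-trans (covers-avoiding S FS f∉S) (≤-reflexive (sumOver-cong (λ _ → refl) y≡y′))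
    where
    y≡y′ : ∀ e → e ∈ S → y e ≡ y′ e
    y≡y′ e e∈S = sym (updateAt-minimal e f y λ { refl → f∉S e∈S })

IsVertex⇒≤1 : {F : Family m} {x : Fin m → ℚ} → IsVertex full F x → ∀ f → x f ≤ 1ℚ
IsVertex⇒≤1 {x = x} ((_ , x≥0 , covers) , extreme) f with x f ≤? 1ℚ
... | yes x≤1 = x≤1
... | no x≰1 = contradiction (y , z , ½ , yP , zP , 0<½ , ½<1 , y≢z , x≡½y+½z) extreme
  where
  x′ = x f + x f - 1ℚ
  1<x′ : 1ℚ < x′
  1<x′ = +-monoˡ-< (- 1ℚ) (+-mono-< (≰⇒> x≰1) (≰⇒> x≰1))
  y = updateAt x f (const 1ℚ)
  z = updateAt x f (const x′)
  yP = InP-updateAt f ≤-refl x≥0 λ S FS _ → covers S FS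
  zP = InP-updateAt f (<⇒≤ 1<x′) x≥0 λ S FS _ → covers S FS
  y≢z : ¬ (∀ e → y e ≡ z e)
  y≢z y≗z = <⇒≢ 1<x′ (trans (sym (updateAt-updates f x)) (trans (y≗z f) (updateAt-updates f x)))
  x≡½y+½z : ∀ e → x e ≡ ½ * y e + (1ℚ - ½) * z e
  x≡½y+½z = updateAt-combination {l = ½} f (λ e _ → combination-self ½ (x e)) (midpoint-reflection (x f))

IsVertex-restrict : {ground ground′ : Subset m} {F F′ : Family m} {x : Fin m → ℚ} →
  InP ground′ F′ x → (∀ w → InP ground′ F′ w → InP ground F w) →
  IsVertex ground F x → IsVertex ground′ F′ x
IsVertex-restrict x∈P′ P′⊆P (_ , extreme) =
  x∈P′ , λ (y , z , l , yP′ , zP′ , rest) → extreme (y , z , l , P′⊆P y yP′ , P′⊆P z zP′ , rest)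

InP-deletion : {F : Family m} {x : Fin m → ℚ} (f : Fin m) → InP full F x →
  InP (minorGround (singleton f) ∅) (Minor F (singleton f) ∅) (updateAt x f (const 0ℚ))
InP-deletion {x = x} f (_ , x≥0 , covers) =
  outside , updateAt-const-preserves (0ℚ ≤_) f ≤-refl x≥0 , covers′
  where
  outside : ∀ e → minorGround (singleton f) ∅ e ≡ false → updateAt x f (const 0ℚ) e ≡ 0ℚ
  outside e e∉ with ∉minorGround {I = singleton f} {∅} e∉
  ... | inj₁ e∈f =
    subst (λ g → updateAt x f (const 0ℚ) g ≡ 0ℚ) (sym (∈-singleton⇒≡ e∈f)) (updateAt-updates f x)
  covers′ : ∀ S → Minor _ (singleton f) ∅ S → 1ℚ ≤ sumOver S (updateAt x f (const 0ℚ))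
  covers′ S ((C , FC , avoids , S≗C) , _) = ≤-trans (covers C FC) (≤-reflexive
    (sumOver-cong (λ e → trans (sym (∧-identityʳ (C e))) (sym (S≗C e)))
                  (λ e e∈C → sym (updateAt-minimal e f x (avoids-singleton⇒≢ avoids e e∈C)))))

InP-deletion⇒vanishes : {F : Family m} {w : Fin m → ℚ} (f : Fin m) →
  InP (minorGround (singleton f) ∅) (Minor F (singleton f) ∅) w → w f ≡ 0ℚ
InP-deletion⇒vanishes f (outside , _) = outside f (∈⇒∉minorGround {I = singleton f} {∅} (∈-singleton f))

InP-deletion⇒InP-updateAt : {F : Family m} {w : Fin m → ℚ} (f : Fin m) {a : ℚ} → 1ℚ ≤ a →
  InP (minorGround (singleton f) ∅) (Minor F (singleton f) ∅) w → InP full F (updateAt w f (const a))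
InP-deletion⇒InP-updateAt f 1≤a wP′@(_ , w≥0 , _) = InP-updateAt f 1≤a w≥0 λ S FS f∉S →
  covers-MinorPre wP′ S (S , FS , ∉⇒avoids-singleton f∉S , λ e → sym (∧-identityʳ (S e)))

IsVertex-deletion : {F : Family m} {x : Fin m → ℚ} (f : Fin m) → IsVertex full F x → 1ℚ ≤ x f →
  IsVertex (minorGround (singleton f) ∅) (Minor F (singleton f) ∅) (updateAt x f (const 0ℚ))
IsVertex-deletion {m} {F} {x} f (xP , extreme) 1≤xf = InP-deletion f xP , extreme′
  where
  P′ : (Fin m → ℚ) → Set
  P′ = InP (minorGround (singleton f) ∅) (Minor F (singleton f) ∅)
  x′ = updateAt x f (const 0ℚ)

  extreme′ : ¬ (∃ λ y → ∃ λ z → ∃ λ l → P′ y × P′ z × (0ℚ < l) × (l < 1ℚ) ×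
                 ¬ (∀ e → y e ≡ z e) × (∀ e → x′ e ≡ l * y e + (1ℚ - l) * z e))
  extreme′ (y , z , l , yP′ , zP′ , 0<l , l<1 , y≢z , x′≡ly+[1-l]z) =
    extreme (y↑ , z↑ , l , InP-deletion⇒InP-updateAt f 1≤xf yP′ , InP-deletion⇒InP-updateAt f 1≤xf zP′ ,
             0<l , l<1 , y↑≢z↑ , x≡ly↑+[1-l]z↑)
    where
    y↑ = updateAt y f (const (x f))
    z↑ = updateAt z f (const (x f))
    y↑≢z↑ : ¬ (∀ e → y↑ e ≡ z↑ e)
    y↑≢z↑ y↑≗z↑ = y≢z λ e → case e ≟ f of λ where
      (yes refl) → trans (InP-deletion⇒vanishes e yP′) (sym (InP-deletion⇒vanishes e zP′))
      (no e≢f)   → trans (sym (updateAt-minimal e f y e≢f)) (trans (y↑≗z↑ e) (updateAt-minimal e f z e≢f))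
    x≡ly↑+[1-l]z↑ : ∀ e → x e ≡ l * y↑ e + (1ℚ - l) * z↑ e
    x≡ly↑+[1-l]z↑ = updateAt-combination {l = l} f
      (λ e e≢f → trans (sym (updateAt-minimal e f x e≢f)) (x′≡ly+[1-l]z e)) (combination-self l (x f))

InP-contraction : {F : Family m} {x : Fin m → ℚ} (e : Fin m) → InP full F x → x e ≡ 0ℚ →
  InP (minorGround ∅ (singleton e)) (Minor F ∅ (singleton e)) x
InP-contraction {x = x} e (_ , x≥0 , covers) xe≡0 = outside , x≥0 , covers′
  where
  outside : ∀ f → minorGround ∅ (singleton e) f ≡ false → x f ≡ 0ℚ
  outside f f∉ with ∉minorGround {I = ∅} {singleton e} f∉
  ... | inj₂ f∈e = vanishes-on-singleton xe≡0 f f∈e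
  covers′ : ∀ S → Minor _ ∅ (singleton e) S → 1ℚ ≤ sumOver S x
  covers′ S ((C , FC , _ , S≗C∖e) , _) = ≤-trans (covers C FC) (≤-reflexive (begin
    sumOver C x                  ≡⟨ sumOver-∖ {S = C} (vanishes-on-singleton xe≡0) ⟨
    sumOver (C ∖ singleton e) x  ≡⟨ sumOver-cong S≗C∖e (λ _ _ → refl) ⟨
    sumOver S x                  ∎))
    where open ≡-Reasoning

InP-contraction⇒InP : {F : Family m} {w : Fin m → ℚ} (e : Fin m) →
  InP (minorGround ∅ (singleton e)) (Minor F ∅ (singleton e)) w → InP full F w
InP-contraction⇒InP e wP′@(_ , w≥0 , _) = (λ _ ()) , w≥0 , λ C FC → ≤-trans
  (covers-MinorPre wP′ (C ∖ singleton e) (C , FC , (λ _ _ → refl) , λ _ → refl))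
  (sumOver-mono w≥0 (∖-⊆ C (singleton e)))

IsVertex-contraction : {F : Family m} {x : Fin m → ℚ} (e : Fin m) → IsVertex full F x → x e ≡ 0ℚ →
  IsVertex (minorGround ∅ (singleton e)) (Minor F ∅ (singleton e)) x
IsVertex-contraction e xV@(xP , _) xe≡0 =
  IsVertex-restrict (InP-contraction e xP xe≡0) (λ _ → InP-contraction⇒InP e) xV

FlowClutter-resp : {G : SignedGraph n m} {S T : Subset m} → (∀ e → S e ≡ T e) →
  FlowClutter G S → FlowClutter G T
FlowClutter-resp S≗T (c , flow , edges) = c , flow , λ e →
  (λ e∈T → proj₁ (edges e) (trans (S≗T e) e∈T)) , λ on-c → trans (sym (S≗T e)) (proj₂ (edges e) on-c)

deletion-isProperStrongMinor : (G : SignedGraph n m) (f : Fin m) → ProperStrongMinor G (singleton f) ∅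
deletion-isProperStrongMinor G f =
  (λ _ _ → refl) , (λ _ ()) , (f , inj₁ (∈-singleton f)) ,
  λ e ((C , FC , _ , e≗C) , _) →
    FlowClutter-resp (λ g → trans (sym (∧-identityʳ (C g))) (sym (e≗C g))) FC

contraction-isProperStrongMinor : (G : SignedGraph n m) {x : Fin m → ℚ} (e : Fin m) → neg G e ≡ false →
  InP full (FlowClutter G) x → x e ≡ 0ℚ → (∀ f → x f < 1ℚ) → ProperStrongMinor G ∅ (singleton e)
contraction-isProperStrongMinor G {x} e e⁺ (_ , _ , covers) xe≡0 x<1 =
  (λ _ ()) , (λ f f∈e → subst (λ g → neg G g ≡ false) (sym (∈-singleton⇒≡ f∈e)) e⁺) ,
  (e , inj₂ (∈-singleton e)) , no-singleton
  where
  no-singleton : ∀ f → Minor (FlowClutter G) ∅ (singleton e) (singleton f) → FlowClutter G (singleton f)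
  no-singleton f ((C , FC , _ , f≗C∖e) , _) =
    contradiction (≤-trans (covers C FC) (≤-reflexive xC≡xf))
      λ 1≤xf → <-irrefl refl (<-≤-trans (x<1 f) 1≤xf)
    where
    open ≡-Reasoning
    xC≡xf : sumOver C x ≡ x f
    xC≡xf = begin
      sumOver C x                 ≡⟨ sumOver-∖ {S = C} (vanishes-on-singleton xe≡0) ⟨
      sumOver (C ∖ singleton e) x ≡⟨ sumOver-cong f≗C∖e (λ _ _ → refl) ⟨
      sumOver (singleton f) x     ≡⟨ sumOver-singleton f x ⟩
      x f                         ∎

lemma4 : ∀ (n m : ℕ) (G : SignedGraph n m) → WeaklyMNI G →
    ∀ (x : Fin m → ℚ) → IsVertex full (FlowClutter G) x → Fractional x →
    (∀ e → neg G e ≡ false → (0ℚ < x e) × (x e < 1ℚ)) ×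
    (∀ e → neg G e ≡ true → x e < 1ℚ)
lemma4 n m G (_ , minors-ideal) x xV@(xP@(_ , x≥0 , _) , _) (k , xk∉ℤ) =
  (λ e e⁺ → 0<x e e⁺ , x<1 e) , (λ e _ → x<1 e)
  where
  x<1 : ∀ f → x f < 1ℚ
  x<1 f with x f <? 1ℚ | k ≟ f
  ... | yes xf<1 | _        = xf<1
  ... | no xf≮1  | yes refl =
    contradiction (ℤ.+ 1 , ≤-antisym (IsVertex⇒≤1 xV k) (≮⇒≥ xf≮1)) xk∉ℤ
  ... | no xf≮1  | no k≢f   =
    contradiction (subst IsInteger (updateAt-minimal k f x k≢f)
      (minors-ideal (singleton f) ∅ (deletion-isProperStrongMinor G f)
                    _ (IsVertex-deletion f xV (≮⇒≥ xf≮1)) k)) xk∉ℤ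

  0<x : ∀ e → neg G e ≡ false → 0ℚ < x e
  0<x e e⁺ with 0ℚ <? x e
  ... | yes 0<xe = 0<xe
  ... | no xe≯0  = contradiction
    (minors-ideal ∅ (singleton e) (contraction-isProperStrongMinor G e e⁺ xP xe≡0 x<1)
                  x (IsVertex-contraction e xV xe≡0) k) xk∉ℤ
    where
    xe≡0 : x e ≡ 0ℚ
    xe≡0 = ≤-antisym (≮⇒≥ xe≯0) (x≥0 e)
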